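{- Let $n\ge2$. (1) For each $w\in S_n$, $|f^{ -1}(w)|=2^{\mathrm{del}_S(w)}$. (2) For each $w\in S_n$ and $v\in A_{n+1}$, $\mathrm{del}_S(w)=\mathrm{del}_S(w^{ -1})$ and $\mathrm{del}_A(v)=\mathrm{del}_A(v^{ -1})$.
   Context: Permutations are multiplied as functions; $s_i=(i,i+1)$. $R^S_j=\{1,s_j,s_js_{j-1},\dots,s_j\cdots s_1\}$ ($1\le j\le n-1$); every $w\in S_n$ factors uniquely as $w_1\cdots w_{n-1}$, $w_j\in R^S_j$, and $\mathrm{del}_S(w)$ is the number of $j$ with $w_j=s_j\cdots s_1$. In $S_{n+1}$, $a_i=s_1s_{i+1}$ ($1\le i\le n-1$), $R^A_j=\{1,a_j,a_ja_{j-1},\dots,a_j\cdots a_2,a_j\cdots a_2a_1,a_j\cdots a_2a_1^{ -1}\}$ ($R^A_1=\{1,a_1,a_1^{ -1}\}$); every $v\in A_{n+1}$ factors uniquely as $v_1\cdots v_{n-1}$, $v_j\in R^A_j$, and $\mathrm{del}_A(v)$ is the number of letters $a_1^{\pm1}$ in this word. The map $f:A_{n+1}\to S_n$ is $f(v)=f(v_1)\cdots f(v_{n-1})$ with $f(1)=1$, $f(a_j\cdots a_k)=s_j\cdots s_k$ ($2\le k\le j$), $f(a_j\cdots a_2a_1^{\pm1})=s_j\cdots s_2s_1$. -}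

module Defs where

open import Data.Nat using (ℕ; zero; suc; _+_; _∸_; _≡ᵇ_; _≤ᵇ_)
open import Data.Fin using (Fin; zero; suc; toℕ)
open import Data.Bool using (Bool; true; false; if_then_else_)
open import Data.Unit using (⊤; tt)
open import Data.Product using (_×_; _,_)
open import Data.List using (List; []; _∷_; map; cartesianProduct; allFin; upTo; filterᵇ; length)
open import Data.Bool using (_∧_)
open import Function using (_∘_; id)

-- Permutations of {1,…,m} are represented as functions ℕ → ℕ
-- (identity outside {1,…,m}); product = composition: (u v)(x) = u (v x).

Perm : Set
Perm = ℕ → ℕ

s : ℕ → Perm
s i x = if x ≡ᵇ i then suc i else (if x ≡ᵇ suc i then i else x)

a : ℕ → Perm
a i = s 1 ∘ s (suc i)

a1⁻¹ : Perm
a1⁻¹ = s 2 ∘ s 1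

descS : ℕ → ℕ → Perm
descS j zero    = id
descS j (suc k) = s j ∘ descS (j ∸ 1) k

descA : ℕ → ℕ → Perm
descA j zero    = id
descA j (suc k) = a j ∘ descA (j ∸ 1) k

-- A word with m factors w_1 ⋯ w_m is coded by
-- the choice, for each j, of an index k into R_j:
--   R^S_j = {1, s_j, s_j s_{j-1}, …, s_j⋯s_1}        : k ∈ Fin (j+1)
--             (k ↦ s_j ⋯ s_{j-k+1})
--   R^A_j = {1, a_j, …, a_j⋯a_2, a_j⋯a_2a_1, a_j⋯a_2a_1^{-1}} : k ∈ Fin (j+2)
--             (k ≤ j ↦ a_j ⋯ a_{j-k+1};  k = j+1 ↦ a_j⋯a_2 a_1^{-1})

SCode : ℕ → Set
SCode zero    = ⊤
SCode (suc m) = SCode m × Fin (suc (suc m))      -- factor j = m+1 : Fin (j+1)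

ACode : ℕ → Set
ACode zero    = ⊤
ACode (suc m) = ACode m × Fin (suc (suc (suc m))) -- factor j = m+1 : Fin (j+2)

factorS : (j : ℕ) → ℕ → Perm
factorS j k = descS j k

factorA : (j : ℕ) → ℕ → Perm
factorA j k = if k ≤ᵇ j then descA j k else (descA j (j ∸ 1) ∘ a1⁻¹)

evalS : (m : ℕ) → SCode m → Perm
evalS zero    tt      = id
evalS (suc m) (c , k) = evalS m c ∘ factorS (suc m) (toℕ k)

evalA : (m : ℕ) → ACode m → Perm
evalA zero    tt      = id
evalA (suc m) (c , k) = evalA m c ∘ factorA (suc m) (toℕ k)

-- del_S: number of j with w_j = s_j ⋯ s_1  (index k = j)
delS : (m : ℕ) → SCode m → ℕ
delS zero    tt      = 0
delS (suc m) (c , k) = (if toℕ k ≡ᵇ suc m then 1 else 0) + delS m c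

-- del_A: number of letters a_1^{±1} in the word  (index k = j or k = j+1)
delA : (m : ℕ) → ACode m → ℕ
delA zero    tt      = 0
delA (suc m) (c , k) = (if suc m ≤ᵇ toℕ k then 1 else 0) + delA m c

-- The map f on factors: a_j⋯a_k ↦ s_j⋯s_k (k ≥ 2), a_j⋯a_2a_1^{±1} ↦ s_j⋯s_1,
-- 1 ↦ 1.  On indices: k ↦ min(k, j).

clamp : (j : ℕ) → Fin (suc (suc j)) → Fin (suc j)
clamp zero    _       = zero
clamp (suc j) zero    = zero
clamp (suc j) (suc k) = suc (clamp j k)

fCode : (m : ℕ) → ACode m → SCode m
fCode zero    tt      = tt
fCode (suc m) (c , k) = fCode m c , clamp (suc m) k

fA : (m : ℕ) → ACode m → Perm
fA m c = evalS m (fCode m c)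

-- enumeration of all words (= all elements, by unique factorization)

allSCode : (m : ℕ) → List (SCode m)
allSCode zero    = tt ∷ []
allSCode (suc m) = cartesianProduct (allSCode m) (allFin (suc (suc m)))

allACode : (m : ℕ) → List (ACode m)
allACode zero    = tt ∷ []
allACode (suc m) = cartesianProduct (allACode m) (allFin (suc (suc (suc m))))

eqOn : ℕ → Perm → Perm → Bool
eqOn n u w = allᵇ (map (λ x → u x ≡ᵇ w x) (map suc (upTo n)))
  where
  allᵇ : List Bool → Bool
  allᵇ []       = true
  allᵇ (b ∷ bs) = b ∧ allᵇ bs

-- words of the paper's S_n and A_{n+1}: n-1 factors
SWord : ℕ → Set
SWord n = SCode (n ∸ 1)

AWord : ℕ → Set
AWord n = ACode (n ∸ 1)

fiberSize : (n : ℕ) → Perm → ℕ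
fiberSize n w = length (filterᵇ (λ v → eqOn n (fA (n ∸ 1) v) w) (allACode (n ∸ 1)))

{-# OPTIONS --safe #-}

-- Multiplying a permutation of {1,…,N} on the right by s_N s_{N-1} ⋯ s_{N+1-k} inserts the
-- new largest value N+1 at position N+1-k of its one-line notation.
--
-- (1) So the last factor of a factorization in S_n is determined by the position of the
-- largest value, and factorizations are unique. On factor indices f is k ↦ min(k, j), which
-- is two-to-one onto k = j (the factor s_j ⋯ s_1) and one-to-one onto every other k, so the
-- fiber of w has 2^del_S(w) elements.
--
-- (2) Count the positions preceded by at most t smaller values. Inserting N+1 at position p
-- adds one such position exactly when p ≤ t+1 and changes no other. For t = 0 and the factor
-- s_j ⋯ s_{j+1-k} this happens iff k = j, so 1 + del_S(w) is the number of left-to-right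
-- minima of w. Since a_i = s_1 s_{i+1} and s_1 commutes with s_{i+1} for i ≥ 2, the k-th
-- element of R^A_j (k = 0, …, j+1) is s_1^k s_{j+1} ⋯ s_{j+2-k}; swapping the first two
-- positions does not change the count for t = 1, and the inserted position counts iff k ≥ j,
-- i.e. iff the factor contains a_1^{±1}. So 2 + del_A(v) is the count for t = 1 of v.
-- Finally, the number of smaller values before position i is the number of points of the
-- graph of w strictly south-west of (i, w i); inverting w transposes the graph, so both
-- counts are invariant under inversion.

module Submission where

open import Defs
open import Data.Bool using (Bool; true; false; T; _∧_; if_then_else_)
open import Data.Bool.ListAction using (and; all)
open import Data.Fin as Fin using (Fin; toℕ)
open import Data.Fin.Properties using (toℕ≤pred[n]; toℕ-injective)
open import Data.List using (List; []; _∷_; _++_; map; length; filterᵇ; upTo; allFin; tabulate; cartesianProduct)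
open import Data.List.Properties using (foldr-universal; filter-++; length-++; map-tabulate)
open import Data.List.Relation.Unary.All.Properties using (all⁺; all⁻; map⁺; map⁻; applyUpTo⁺₁; applyUpTo⁻)
open import Data.Nat using (ℕ; zero; suc; pred; _+_; _*_; _^_; _∸_; _≤_; _<_; _≡ᵇ_; s≤s; z≤n; s≤s⁻¹)
open import Data.Nat.Properties
  using ( _≟_; _<?_; _≤?_; <-cmp; ≤-refl; ≤-reflexive; ≤-trans; <-trans; ≤-<-trans; <-≤-trans; <⇒≤
        ; <-irrefl; <-asym; ≤⇒≯; <⇒≱; <⇒≢; ≮⇒≥; ≤-antisym; n<1+n; n≤1+n; m≤n⇒m≤1+n; m≤n⇒m<n∨m≡n
        ; <⇒≤pred; pred-mono-≤; m∸n≤m; m≤n⇒m∸n≡0; m<n⇒0<n∸m; m≤n+o⇒m∸n≤o; m≤n+m∸n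
        ; pred[m∸n]≡m∸[1+n]; ∸-cancelˡ-≡; suc-injective; ≡ᵇ⇒≡; ≡⇒≡ᵇ; +-comm; +-identityʳ; +-mono-≤
        ; +-monoʳ-≤; *-identityʳ; *-zeroʳ; *-comm; *-monoʳ-≤; ^-distribˡ-+-*; +-commutativeSemigroup )
open import Algebra.Properties.CommutativeSemigroup +-commutativeSemigroup using (interchange)
open import Data.Product using (_×_; ∃-syntax; _,_; proj₁; proj₂; uncurry)
open import Data.Product.Properties using (,-injective)
open import Data.Sum using (_⊎_; inj₁; inj₂)
open import Data.Unit using (tt)
open import Function using (_∘_; id; _⇔_; mk⇔; Equivalence)
open import Relation.Binary.Definitions using (DecidableEquality; tri<; tri≈; tri>)
open import Relation.Binary.PropositionalEquality
  using (_≡_; _≢_; _≗_; refl; sym; trans; cong; cong₂; subst; subst₂; module ≡-Reasoning)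
open import Relation.Nullary using (Dec; yes; no; does; ¬_; contradiction)
open import Relation.Nullary.Decidable using (dec-true; dec-false; does-⇔; T?; _×-dec_)
import Relation.Nullary.Decidable as Dec

open ≡-Reasoning

⟦_⟧ : {A : Set} → Dec A → ℕ
⟦ a? ⟧ = if does a? then 1 else 0

⟦⟧-yes : {A : Set} (a? : Dec A) → A → ⟦ a? ⟧ ≡ 1
⟦⟧-yes a? a = cong (if_then 1 else 0) (dec-true a? a)

⟦⟧-no : {A : Set} (a? : Dec A) → ¬ A → ⟦ a? ⟧ ≡ 0
⟦⟧-no a? ¬a = cong (if_then 1 else 0) (dec-false a? ¬a)

⟦⟧-cong : {A B : Set} → A ⇔ B → (a? : Dec A) (b? : Dec B) → ⟦ a? ⟧ ≡ ⟦ b? ⟧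
⟦⟧-cong A⇔B a? b? = cong (if_then 1 else 0) (does-⇔ A⇔B a? b?)

⟦⟧≤1 : {A : Set} (a? : Dec A) → ⟦ a? ⟧ ≤ 1
⟦⟧≤1 (true  Dec.because _) = ≤-refl
⟦⟧≤1 (false Dec.because _) = z≤n

infix 4 _∈[1,_]

_∈[1,_] : ℕ → ℕ → Set
x ∈[1, N ] = 1 ≤ x × x ≤ N

∈-widen : ∀ {x N} → x ∈[1, N ] → x ∈[1, suc N ]
∈-widen (1≤x , x≤N) = 1≤x , m≤n⇒m≤1+n x≤N

∈-top : ∀ {N} → suc N ∈[1, suc N ]
∈-top = s≤s z≤n , ≤-refl

∈-split : ∀ {x N} → x ∈[1, suc N ] → x ∈[1, N ] ⊎ x ≡ suc N
∈-split (1≤x , x≤) with m≤n⇒m<n∨m≡n x≤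
... | inj₁ x< = inj₁ (1≤x , s≤s⁻¹ x<)
... | inj₂ x≡ = inj₂ x≡

sumTo : ℕ → (ℕ → ℕ) → ℕ
sumTo zero    f = 0
sumTo (suc N) f = sumTo N f + f (suc N)

sumTo-cong : ∀ N {f g : ℕ → ℕ} → (∀ {i} → i ∈[1, N ] → f i ≡ g i) → sumTo N f ≡ sumTo N g
sumTo-cong zero    f≗g = refl
sumTo-cong (suc N) f≗g = cong₂ _+_ (sumTo-cong N (f≗g ∘ ∈-widen)) (f≗g ∈-top)

sumTo-zero : ∀ N {f : ℕ → ℕ} → (∀ {i} → i ∈[1, N ] → f i ≡ 0) → sumTo N f ≡ 0
sumTo-zero zero    f≗0 = refl
sumTo-zero (suc N) f≗0 = cong₂ _+_ (sumTo-zero N (f≗0 ∘ ∈-widen)) (f≗0 ∈-top)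

sumTo-mono-≤ : ∀ N {f g : ℕ → ℕ} → (∀ {i} → i ∈[1, N ] → f i ≤ g i) → sumTo N f ≤ sumTo N g
sumTo-mono-≤ zero    f≤g = z≤n
sumTo-mono-≤ (suc N) f≤g = +-mono-≤ (sumTo-mono-≤ N (f≤g ∘ ∈-widen)) (f≤g ∈-top)

sumTo-+ : ∀ N (f g : ℕ → ℕ) → sumTo N (λ i → f i + g i) ≡ sumTo N f + sumTo N g
sumTo-+ zero    f g = refl
sumTo-+ (suc N) f g =
  trans (cong (_+ (f (suc N) + g (suc N))) (sumTo-+ N f g))
        (interchange (sumTo N f) (sumTo N g) (f (suc N)) (g (suc N)))

sumTo-comm : ∀ N M (f : ℕ → ℕ → ℕ) →
             sumTo N (λ i → sumTo M (f i)) ≡ sumTo M (λ j → sumTo N (λ i → f i j))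
sumTo-comm zero    M f = sym (sumTo-zero M (λ _ → refl))
sumTo-comm (suc N) M f =
  trans (cong (_+ sumTo M (f (suc N))) (sumTo-comm N M f)) (sym (sumTo-+ M _ (f (suc N))))

sumTo-indicator : ∀ N (g : ℕ → ℕ) {x} → x ∈[1, N ] → sumTo N (λ j → ⟦ x ≟ j ⟧ * g j) ≡ g x
sumTo-indicator zero    g (() , z≤n)
sumTo-indicator (suc N) g {x} x∈ with ∈-split x∈
... | inj₁ x∈N@(_ , x≤N) = begin
  sumTo N (λ j → ⟦ x ≟ j ⟧ * g j) + ⟦ x ≟ suc N ⟧ * g (suc N)
    ≡⟨ cong₂ _+_ (sumTo-indicator N g x∈N) (cong (_* g (suc N)) (⟦⟧-no (x ≟ suc N) (<⇒≢ (s≤s x≤N)))) ⟩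
  g x + 0
    ≡⟨ +-identityʳ (g x) ⟩
  g x ∎
... | inj₂ refl = begin
  sumTo N (λ j → ⟦ suc N ≟ j ⟧ * g j) + ⟦ suc N ≟ suc N ⟧ * g (suc N)
    ≡⟨ cong₂ _+_ (sumTo-zero N (λ (_ , j≤N) → cong (_* _) (⟦⟧-no (suc N ≟ _) (<⇒≢ (s≤s j≤N) ∘ sym))))
                 (cong (_* g (suc N)) (⟦⟧-yes (suc N ≟ suc N) refl)) ⟩
  0 + (g (suc N) + 0)
    ≡⟨ +-identityʳ (g (suc N)) ⟩
  g (suc N) ∎

sumTo-<-all : ∀ M {a} → M < a → sumTo M (λ q → ⟦ q <? a ⟧) ≡ M
sumTo-<-all zero    _   = refl
sumTo-<-all (suc M) M<a =
  trans (cong₂ _+_ (sumTo-<-all M (<-trans (n<1+n M) M<a)) (⟦⟧-yes (suc M <? _) M<a)) (+-comm M 1)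

sumTo-< : ∀ M {a} → a ≤ suc M → sumTo M (λ q → ⟦ q <? a ⟧) ≡ pred a
sumTo-< zero    a≤1 = sym (m≤n⇒m∸n≡0 a≤1)
sumTo-< (suc M) a≤ with m≤n⇒m<n∨m≡n a≤
... | inj₁ a<    = trans (cong₂ _+_ (sumTo-< M (s≤s⁻¹ a<)) (⟦⟧-no (suc M <? _) (≤⇒≯ (s≤s⁻¹ a<))))
                         (+-identityʳ _)
... | inj₂ refl = sumTo-<-all (suc M) ≤-refl

record Permutes (N : ℕ) (f : Perm) : Set where
  field
    into         : ∀ {x} → x ∈[1, N ] → f x ∈[1, N ]
    onto         : ∀ {y} → y ∈[1, N ] → ∃[ x ] x ∈[1, N ] × f x ≡ y
    fixes-beyond : ∀ {x} → N < x → f x ≡ x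

open Permutes

InjectiveOn : ℕ → Perm → Set
InjectiveOn N f = ∀ {x y} → x ∈[1, N ] → y ∈[1, N ] → f x ≡ f y → x ≡ y

Permutes-id : ∀ {N} → Permutes N id
Permutes-id = record { into = id ; onto = λ y∈ → _ , y∈ , refl ; fixes-beyond = λ _ → refl }

Permutes-∘ : ∀ {N f g} → Permutes N f → Permutes N g → Permutes N (f ∘ g)
Permutes-∘ {f = f} F G = record
  { into         = into F ∘ into G
  ; onto         = λ z∈ → let y , y∈ , fy≡z = onto F z∈
                              x , x∈ , gx≡y = onto G y∈
                          in x , x∈ , trans (cong f gx≡y) fy≡z
  ; fixes-beyond = λ N<x → trans (cong f (fixes-beyond G N<x)) (fixes-beyond F N<x)
  }

Permutes-≗ : ∀ {N f g} → f ≗ g → Permutes N f → Permutes N g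
Permutes-≗ {N} f≗g F = record
  { into         = λ x∈ → subst (_∈[1, N ]) (f≗g _) (into F x∈)
  ; onto         = λ y∈ → let x , x∈ , fx≡y = onto F y∈ in x , x∈ , trans (sym (f≗g x)) fx≡y
  ; fixes-beyond = λ N<x → trans (sym (f≗g _)) (fixes-beyond F N<x)
  }

Permutes-suc : ∀ {N f} → Permutes N f → Permutes (suc N) f
Permutes-suc {N} {f} F = record
  { into         = into′
  ; onto         = onto′
  ; fixes-beyond = λ N+1<x → fixes-beyond F (<-trans (n<1+n N) N+1<x)
  }
  where
  top-fixed : f (suc N) ≡ suc N
  top-fixed = fixes-beyond F (n<1+n N)

  into′ : ∀ {x} → x ∈[1, suc N ] → f x ∈[1, suc N ]
  into′ x∈ with ∈-split x∈
  ... | inj₁ x∈N  = ∈-widen (into F x∈N)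
  ... | inj₂ refl = subst (_∈[1, suc N ]) (sym top-fixed) ∈-top

  onto′ : ∀ {y} → y ∈[1, suc N ] → ∃[ x ] x ∈[1, suc N ] × f x ≡ y
  onto′ y∈ with ∈-split y∈
  ... | inj₁ y∈N  = let x , x∈ , fx≡y = onto F y∈N in x , ∈-widen x∈ , fx≡y
  ... | inj₂ refl = suc N , ∈-top , top-fixed

sumTo-reindex : ∀ N {f} → Permutes N f → InjectiveOn N f → ∀ G → sumTo N (G ∘ f) ≡ sumTo N G
sumTo-reindex N {f} F f-inj G = begin
  sumTo N (G ∘ f)                                    ≡⟨ sumTo-cong N (λ q∈ → sym (sumTo-indicator N G (into F q∈))) ⟩
  sumTo N (λ q → sumTo N (λ r → ⟦ f q ≟ r ⟧ * G r))  ≡⟨ sumTo-comm N N _ ⟩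
  sumTo N (λ r → sumTo N (λ q → ⟦ f q ≟ r ⟧ * G r))  ≡⟨ sumTo-cong N column ⟩
  sumTo N G                                          ∎
  where
  column : ∀ {r} → r ∈[1, N ] → sumTo N (λ q → ⟦ f q ≟ r ⟧ * G r) ≡ G r
  column r∈ with onto F r∈
  ... | q₀ , q₀∈ , refl = begin
    sumTo N (λ q → ⟦ f q ≟ f q₀ ⟧ * G (f q₀))  ≡⟨ sumTo-cong N (λ q∈ → cong (_* G (f q₀)) (same-point q∈)) ⟩
    sumTo N (λ q → ⟦ q₀ ≟ q ⟧ * G (f q₀))      ≡⟨ sumTo-indicator N (λ _ → G (f q₀)) q₀∈ ⟩
    G (f q₀)                                   ∎
    where
    same-point : ∀ {q} → q ∈[1, N ] → ⟦ f q ≟ f q₀ ⟧ ≡ ⟦ q₀ ≟ q ⟧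
    same-point q∈ = ⟦⟧-cong (mk⇔ (sym ∘ f-inj q∈ q₀∈) (cong f ∘ sym)) (f _ ≟ _) (q₀ ≟ _)

s-left : ∀ i → s i i ≡ suc i
s-left i rewrite dec-true (i ≟ i) refl = refl

s-right : ∀ i → s i (suc i) ≡ i
s-right i rewrite dec-false (suc i ≟ i) (<⇒≢ (n<1+n i) ∘ sym) | dec-true (suc i ≟ suc i) refl = refl

s-other : ∀ {i x} → x ≢ i → x ≢ suc i → s i x ≡ x
s-other {i} {x} x≢i x≢i+1 rewrite dec-false (x ≟ i) x≢i | dec-false (x ≟ suc i) x≢i+1 = refl

s₁-involutive : ∀ x → s 1 (s 1 x) ≡ x
s₁-involutive 0               = refl
s₁-involutive 1               = refl
s₁-involutive 2               = refl
s₁-involutive (suc (suc (suc x))) = refl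

s₁-permutes : ∀ {N} → 2 ≤ N → Permutes N (s 1)
s₁-permutes {N} 2≤N = record
  { into         = into′
  ; onto         = λ {y} y∈ → s 1 y , into′ y∈ , s₁-involutive y
  ; fixes-beyond = fixes
  }
  where
  into′ : ∀ {x} → x ∈[1, N ] → s 1 x ∈[1, N ]
  into′ {1}                 _  = s≤s z≤n , 2≤N
  into′ {2}                 _  = s≤s z≤n , ≤-trans (s≤s z≤n) 2≤N
  into′ {suc (suc (suc x))} x∈ = x∈

  fixes : ∀ {x} → N < x → s 1 x ≡ x
  fixes {1}                 N<1 = contradiction (≤-trans (s≤s z≤n) 2≤N) (<⇒≱ N<1)
  fixes {2}                 N<2 = contradiction 2≤N (<⇒≱ N<2)
  fixes {suc (suc (suc x))} _   = refl

s₁-injective : ∀ {N} → InjectiveOn N (s 1)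
s₁-injective {x = x} {y} _ _ s₁x≡s₁y =
  trans (sym (s₁-involutive x)) (trans (cong (s 1) s₁x≡s₁y) (s₁-involutive y))

s-≥3 : ∀ {i x} → 3 ≤ i → 3 ≤ x → 3 ≤ s i x
s-≥3 {i} {x} 3≤i 3≤x with x ≡ᵇ i | x ≡ᵇ suc i
... | true  | _     = m≤n⇒m≤1+n 3≤i
... | false | true  = 3≤i
... | false | false = 3≤x

s₁-fixes-≥3 : ∀ {x} → 3 ≤ x → s 1 x ≡ x
s₁-fixes-≥3 (s≤s (s≤s (s≤s _))) = refl

s-s₁-comm : ∀ {i} → 3 ≤ i → s i ∘ s 1 ≗ s 1 ∘ s i
s-s₁-comm (s≤s (s≤s (s≤s _))) 0 = refl
s-s₁-comm (s≤s (s≤s (s≤s _))) 1 = refl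
s-s₁-comm (s≤s (s≤s (s≤s _))) 2 = refl
s-s₁-comm 3≤i@(s≤s (s≤s (s≤s _))) (suc (suc (suc x))) =
  sym (s₁-fixes-≥3 (s-≥3 {x = suc (suc (suc x))} 3≤i (s≤s (s≤s (s≤s z≤n)))))

s₁^ : ℕ → Perm
s₁^ zero    = id
s₁^ (suc k) = s 1 ∘ s₁^ k

s-s₁^-comm : ∀ {i} → 3 ≤ i → ∀ k → s i ∘ s₁^ k ≗ s₁^ k ∘ s i
s-s₁^-comm 3≤i zero    x = refl
s-s₁^-comm 3≤i (suc k) x = trans (s-s₁-comm 3≤i (s₁^ k x)) (cong (s 1) (s-s₁^-comm 3≤i k x))

s₁^-permutes : ∀ {N} → 2 ≤ N → ∀ k → Permutes N (s₁^ k)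
s₁^-permutes 2≤N zero    = Permutes-id
s₁^-permutes 2≤N (suc k) = Permutes-∘ (s₁-permutes 2≤N) (s₁^-permutes 2≤N k)

-- Inserting a new largest value

-- Closed form of s_N ⋯ s_p: w ∘ toTop N p is w with the value N+1 inserted at position p.
toTop : ℕ → ℕ → Perm
toTop N p x =
  if does (x <? p) then x
  else if does (x ≟ p) then suc N
  else if does (x ≤? suc N) then pred x
  else x

toTop-< : ∀ {N p x} → x < p → toTop N p x ≡ x
toTop-< {N} {p} {x} x<p rewrite dec-true (x <? p) x<p = refl

toTop-p : ∀ N p → toTop N p p ≡ suc N
toTop-p N p rewrite dec-false (p <? p) (<-irrefl refl) | dec-true (p ≟ p) refl = refl

toTop-> : ∀ {N p x} → p < x → x ≤ suc N → toTop N p x ≡ pred x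
toTop-> {N} {p} {x} p<x x≤
  rewrite dec-false (x <? p) (<-asym p<x) | dec-false (x ≟ p) (<⇒≢ p<x ∘ sym) | dec-true (x ≤? suc N) x≤
  = refl

toTop-beyond : ∀ {N p x} → p < x → suc N < x → toTop N p x ≡ x
toTop-beyond {N} {p} {x} p<x N+1<x
  rewrite dec-false (x <? p) (<-asym p<x) | dec-false (x ≟ p) (<⇒≢ p<x ∘ sym)
        | dec-false (x ≤? suc N) (<⇒≱ N+1<x)
  = refl

s-toTop : ∀ {N p} → p ≤ suc N → s (suc N) ∘ toTop N p ≗ toTop (suc N) p
s-toTop {N} {p} p≤ x with <-cmp x p
... | tri< x<p _ _ = begin
  s (suc N) (toTop N p x)  ≡⟨ cong (s (suc N)) (toTop-< x<p) ⟩
  s (suc N) x              ≡⟨ s-other (<⇒≢ x<N+1) (<⇒≢ (m≤n⇒m≤1+n x<N+1)) ⟩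
  x                        ≡⟨ toTop-< x<p ⟨
  toTop (suc N) p x        ∎
  where x<N+1 = <-≤-trans x<p p≤
... | tri≈ _ refl _ = begin
  s (suc N) (toTop N p p)  ≡⟨ cong (s (suc N)) (toTop-p N p) ⟩
  s (suc N) (suc N)        ≡⟨ s-left (suc N) ⟩
  suc (suc N)              ≡⟨ toTop-p (suc N) p ⟨
  toTop (suc N) p p        ∎
... | tri> _ _ p<x with <-cmp x (suc (suc N))
...   | tri< x<N+2 _ _ = begin
  s (suc N) (toTop N p x)  ≡⟨ cong (s (suc N)) (toTop-> p<x (s≤s⁻¹ x<N+2)) ⟩
  s (suc N) (pred x)       ≡⟨ s-other (<⇒≢ x-1<N+1) (<⇒≢ (m≤n⇒m≤1+n x-1<N+1)) ⟩
  pred x                   ≡⟨ toTop-> p<x (<⇒≤ x<N+2) ⟨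
  toTop (suc N) p x        ∎
  where x-1<N+1 = s≤s (pred-mono-≤ (s≤s⁻¹ x<N+2))
...   | tri≈ _ refl _ = begin
  s (suc N) (toTop N p (suc (suc N)))  ≡⟨ cong (s (suc N)) (toTop-beyond p<x (n<1+n (suc N))) ⟩
  s (suc N) (suc (suc N))              ≡⟨ s-right (suc N) ⟩
  suc N                                ≡⟨ toTop-> p<x ≤-refl ⟨
  toTop (suc N) p (suc (suc N))        ∎
...   | tri> _ _ N+2<x = begin
  s (suc N) (toTop N p x)  ≡⟨ cong (s (suc N)) (toTop-beyond p<x (<-trans (n<1+n (suc N)) N+2<x)) ⟩
  s (suc N) x              ≡⟨ s-other (<⇒≢ (<-trans (n<1+n (suc N)) N+2<x) ∘ sym) (<⇒≢ N+2<x ∘ sym) ⟩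
  x                        ≡⟨ toTop-beyond p<x N+2<x ⟨
  toTop (suc N) p x        ∎

descS-toTop : ∀ {N k} → k ≤ N → descS N k ≗ toTop N (suc N ∸ k)
descS-toTop {N} {zero} _ x with <-cmp x (suc N)
... | tri< x<N+1 _ _  = sym (toTop-< x<N+1)
... | tri≈ _ refl _   = sym (toTop-p N (suc N))
... | tri> _ _ N+1<x  = sym (toTop-beyond N+1<x N+1<x)
descS-toTop {suc N} {suc k} (s≤s k≤N) x =
  trans (cong (s (suc N)) (descS-toTop k≤N x)) (s-toTop (m∸n≤m (suc N) k) x)

insertion-point∈ : ∀ {N k} → k ≤ N → suc N ∸ k ∈[1, suc N ]
insertion-point∈ {N} {k} k≤N = m<n⇒0<n∸m (s≤s k≤N) , m∸n≤m (suc N) k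

module _ {N p : ℕ} (p∈ : p ∈[1, suc N ]) where

  toTop-below : ∀ {x} → x ∈[1, suc N ] → x ≢ p → toTop N p x ∈[1, N ]
  toTop-below {x} (1≤x , x≤N+1) x≢p with <-cmp x p
  ... | tri< x<p _ _ = subst (_∈[1, N ]) (sym (toTop-< x<p)) (1≤x , s≤s⁻¹ (<-≤-trans x<p (proj₂ p∈)))
  ... | tri≈ _ x≡p _ = contradiction x≡p x≢p
  ... | tri> _ _ p<x = subst (_∈[1, N ]) (sym (toTop-> p<x x≤N+1))
                             (≤-trans (proj₁ p∈) (<⇒≤pred p<x) , pred-mono-≤ x≤N+1)

  top≢below : ∀ {x} → x ∈[1, suc N ] → x ≢ p → suc N ≢ toTop N p x
  top≢below x∈ x≢p = <⇒≢ (s≤s (proj₂ (toTop-below x∈ x≢p))) ∘ sym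

  toTop-permutes : Permutes (suc N) (toTop N p)
  toTop-permutes = record
    { into         = into′
    ; onto         = onto′
    ; fixes-beyond = λ N+1<x → toTop-beyond (≤-<-trans (proj₂ p∈) N+1<x) N+1<x
    }
    where
    into′ : ∀ {x} → x ∈[1, suc N ] → toTop N p x ∈[1, suc N ]
    into′ {x} x∈ with x ≟ p
    ... | yes refl = subst (_∈[1, suc N ]) (sym (toTop-p N p)) ∈-top
    ... | no x≢p   = ∈-widen (toTop-below x∈ x≢p)

    onto′ : ∀ {y} → y ∈[1, suc N ] → ∃[ x ] x ∈[1, suc N ] × toTop N p x ≡ y
    onto′ {y} y∈ with ∈-split y∈
    ... | inj₂ refl = p , p∈ , toTop-p N p
    ... | inj₁ y∈N@(_ , y≤N) with y <? p
    ...   | yes y<p = y , ∈-widen y∈N , toTop-< y<p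
    ...   | no  y≮p = suc y , (s≤s z≤n , s≤s y≤N) , toTop-> (s≤s (≮⇒≥ y≮p)) (s≤s y≤N)

  toTop-mono : ∀ {x y} → x ∈[1, suc N ] → y ∈[1, suc N ] → x ≢ p → y ≢ p →
               x < y → toTop N p x < toTop N p y
  toTop-mono {x} {y} (1≤x , _) (_ , y≤N+1) x≢p y≢p x<y with <-cmp x p | <-cmp y p
  ... | tri≈ _ x≡p _ | _              = contradiction x≡p x≢p
  ... | _            | tri≈ _ y≡p _   = contradiction y≡p y≢p
  ... | tri< x<p _ _ | tri< y<p _ _   = subst₂ _<_ (sym (toTop-< x<p)) (sym (toTop-< y<p)) x<y
  ... | tri< x<p _ _ | tri> _ _ p<y   =
    subst₂ _<_ (sym (toTop-< x<p)) (sym (toTop-> p<y y≤N+1)) (<-≤-trans x<p (<⇒≤pred p<y))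
  ... | tri> _ _ p<x | tri< y<p _ _   = contradiction (<-trans x<y y<p) (<-asym p<x)
  ... | tri> _ _ p<x | tri> _ _ p<y   =
    subst₂ _<_ (sym (toTop-> p<x (≤-trans (<⇒≤ x<y) y≤N+1))) (sym (toTop-> p<y y≤N+1)) (pred-mono-<′ 1≤x x<y)
    where
    pred-mono-<′ : ∀ {m n} → 1 ≤ m → m < n → pred m < pred n
    pred-mono-<′ (s≤s z≤n) (s≤s m<n) = m<n

  toTop-reflects-< : ∀ {x y} → x ∈[1, suc N ] → y ∈[1, suc N ] → x ≢ p → y ≢ p →
                     ⟦ x <? y ⟧ ≡ ⟦ toTop N p x <? toTop N p y ⟧
  toTop-reflects-< {x} {y} x∈ y∈ x≢p y≢p =
    ⟦⟧-cong (mk⇔ (toTop-mono x∈ y∈ x≢p y≢p) reflect) (x <? y) (toTop N p x <? toTop N p y)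
    where
    reflect : toTop N p x < toTop N p y → x < y
    reflect Dx<Dy with <-cmp x y
    ... | tri< x<y _ _ = x<y
    ... | tri≈ _ refl _ = contradiction Dx<Dy (<-irrefl refl)
    ... | tri> _ _ y<x = contradiction Dx<Dy (<-asym (toTop-mono y∈ x∈ y≢p x≢p y<x))

  toTop-injective : InjectiveOn (suc N) (toTop N p)
  toTop-injective {x} {y} x∈ y∈ Dx≡Dy with x ≟ p | y ≟ p
  ... | yes refl | yes refl = refl
  ... | yes refl | no y≢p   = contradiction (trans (sym (toTop-p N p)) Dx≡Dy) (top≢below y∈ y≢p)
  ... | no x≢p   | yes refl = contradiction (trans (sym (toTop-p N p)) (sym Dx≡Dy)) (top≢below x∈ x≢p)
  ... | no x≢p   | no y≢p with <-cmp x y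
  ...   | tri< x<y _ _ = contradiction Dx≡Dy (<⇒≢ (toTop-mono x∈ y∈ x≢p y≢p x<y))
  ...   | tri≈ _ x≡y _ = x≡y
  ...   | tri> _ _ y<x = contradiction (sym Dx≡Dy) (<⇒≢ (toTop-mono y∈ x∈ y≢p x≢p y<x))

-- Positions with few smaller values before them

southWest : ℕ → Perm → ℕ → ℕ → ℕ
southWest N w i j = sumTo N (λ q → ⟦ q <? i ⟧ * ⟦ w q <? j ⟧)

-- For t = 0: the number of left-to-right minima.
leftMinima : ℕ → ℕ → Perm → ℕ
leftMinima t N w = sumTo N (λ i → ⟦ southWest N w i (w i) ≤? t ⟧)

leftMinima-cong : ∀ t N {f g} → f ≗ g → leftMinima t N f ≡ leftMinima t N g
leftMinima-cong t N {f} {g} f≗g = sumTo-cong N (λ {i} _ → cong (λ n → ⟦ n ≤? t ⟧) (southWest≡ {i}))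
  where
  southWest≡ : ∀ {i} → southWest N f i (f i) ≡ southWest N g i (g i)
  southWest≡ {i} = sumTo-cong N (λ {q} _ → cong₂ (λ a b → ⟦ q <? i ⟧ * ⟦ a <? b ⟧) (f≗g q) (f≗g i))

leftInverse⇒injectiveOn : ∀ {N u w} → (∀ x → u (w x) ≡ x) → InjectiveOn N w
leftInverse⇒injectiveOn {u = u} u∘w {x} {y} _ _ wx≡wy = trans (sym (u∘w x)) (trans (cong u wx≡wy) (u∘w y))

southWest-inverse : ∀ {N u w} → Permutes N w → (∀ x → u (w x) ≡ x) →
                    ∀ i j → southWest N u i j ≡ southWest N w j i
southWest-inverse {N} {u} {w} W u∘w i j = begin
  sumTo N (λ q → ⟦ q <? i ⟧ * ⟦ u q <? j ⟧)        ≡⟨ sumTo-reindex N W (leftInverse⇒injectiveOn {u = u} u∘w) _ ⟨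
  sumTo N (λ q → ⟦ w q <? i ⟧ * ⟦ u (w q) <? j ⟧)  ≡⟨ sumTo-cong N (λ {q} _ → transpose q) ⟩
  sumTo N (λ q → ⟦ q <? j ⟧ * ⟦ w q <? i ⟧)        ∎
  where
  transpose : ∀ q → ⟦ w q <? i ⟧ * ⟦ u (w q) <? j ⟧ ≡ ⟦ q <? j ⟧ * ⟦ w q <? i ⟧
  transpose q = trans (cong (λ x → ⟦ w q <? i ⟧ * ⟦ x <? j ⟧) (u∘w q)) (*-comm ⟦ w q <? i ⟧ ⟦ q <? j ⟧)

leftMinima-inverse : ∀ t {N u w} → Permutes N w → (∀ x → u (w x) ≡ x) →
                     leftMinima t N u ≡ leftMinima t N w
leftMinima-inverse t {N} {u} {w} W u∘w = begin
  sumTo N (λ i → ⟦ southWest N u i (u i) ≤? t ⟧)          ≡⟨ sumTo-reindex N W (leftInverse⇒injectiveOn {u = u} u∘w) _ ⟨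
  sumTo N (λ j → ⟦ southWest N u (w j) (u (w j)) ≤? t ⟧)  ≡⟨ sumTo-cong N (λ {j} _ → cong (λ n → ⟦ n ≤? t ⟧) (transpose j)) ⟩
  sumTo N (λ j → ⟦ southWest N w j (w j) ≤? t ⟧)          ∎
  where
  transpose : ∀ j → southWest N u (w j) (u (w j)) ≡ southWest N w j (w j)
  transpose j = trans (cong (southWest N u (w j)) (u∘w j)) (southWest-inverse W u∘w (w j) j)

⟦top<?⟧ : ∀ {N x} → x ≤ N → ⟦ suc N <? x ⟧ ≡ 0
⟦top<?⟧ {N} {x} x≤N = ⟦⟧-no (suc N <? x) (≤⇒≯ (m≤n⇒m≤1+n x≤N))

module _ {N p : ℕ} {w : Perm} (p∈ : p ∈[1, suc N ]) (W : Permutes N w) where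

  private
    w-top : w (suc N) ≡ suc N
    w-top = fixes-beyond W (n<1+n N)

    below : ∀ {x} → x ∈[1, suc N ] → x ≢ p → toTop N p x ≤ N
    below x∈ x≢p = proj₂ (toTop-below p∈ x∈ x≢p)

    w-below : ∀ {x} → x ∈[1, suc N ] → x ≢ p → w (toTop N p x) ≤ N
    w-below x∈ x≢p = proj₂ (into W (toTop-below p∈ x∈ x≢p))

  southWest-insert : ∀ {i} → i ∈[1, suc N ] → i ≢ p →
                     southWest (suc N) (w ∘ toTop N p) i (w (toTop N p i))
                       ≡ southWest N w (toTop N p i) (w (toTop N p i))
  southWest-insert {i} i∈ i≢p = begin
    sumTo (suc N) (λ q → ⟦ q <? i ⟧ * ⟦ w (D q) <? w (D i) ⟧)  ≡⟨ sumTo-cong (suc N) termwise ⟩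
    sumTo (suc N) (G ∘ D)                                     ≡⟨ sumTo-reindex (suc N) (toTop-permutes p∈) (toTop-injective p∈) G ⟩
    southWest N w (D i) (w (D i)) + G (suc N)                 ≡⟨ cong (southWest N w (D i) (w (D i)) +_) G-top ⟩
    southWest N w (D i) (w (D i)) + 0                         ≡⟨ +-identityʳ _ ⟩
    southWest N w (D i) (w (D i))                             ∎
    where
    D = toTop N p

    G : ℕ → ℕ
    G r = ⟦ r <? D i ⟧ * ⟦ w r <? w (D i) ⟧

    G-top : G (suc N) ≡ 0
    G-top = cong (_* ⟦ w (suc N) <? w (D i) ⟧) (⟦top<?⟧ (below i∈ i≢p))

    termwise : ∀ {q} → q ∈[1, suc N ] → ⟦ q <? i ⟧ * ⟦ w (D q) <? w (D i) ⟧ ≡ G (D q)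
    termwise {q} q∈ with q ≟ p
    ... | no q≢p   = cong (_* ⟦ w (D q) <? w (D i) ⟧) (toTop-reflects-< p∈ q∈ i∈ q≢p i≢p)
    ... | yes refl rewrite toTop-p N p | w-top = begin
      ⟦ p <? i ⟧ * ⟦ suc N <? w (D i) ⟧      ≡⟨ cong (⟦ p <? i ⟧ *_) (⟦top<?⟧ (w-below i∈ i≢p)) ⟩
      ⟦ p <? i ⟧ * 0                         ≡⟨ *-zeroʳ ⟦ p <? i ⟧ ⟩
      0                                      ≡⟨ cong (_* ⟦ suc N <? w (D i) ⟧) (⟦top<?⟧ (below i∈ i≢p)) ⟨
      ⟦ suc N <? D i ⟧ * ⟦ suc N <? w (D i) ⟧ ∎

  southWest-insert-at : southWest (suc N) (w ∘ toTop N p) p (w (toTop N p p)) ≡ pred p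
  southWest-insert-at = trans (sumTo-cong (suc N) termwise) (sumTo-< (suc N) (m≤n⇒m≤1+n (proj₂ p∈)))
    where
    D = toTop N p

    termwise : ∀ {q} → q ∈[1, suc N ] → ⟦ q <? p ⟧ * ⟦ w (D q) <? w (D p) ⟧ ≡ ⟦ q <? p ⟧
    termwise {q} q∈ with q ≟ p
    ... | yes refl = trans (cong (_* ⟦ w (D p) <? w (D p) ⟧) p≮p) (sym p≮p)
      where p≮p = ⟦⟧-no (p <? p) (<-irrefl refl)
    ... | no q≢p   = trans (cong (⟦ q <? p ⟧ *_) (⟦⟧-yes (w (D q) <? w (D p)) wDq<wDp)) (*-identityʳ ⟦ q <? p ⟧)
      where
      wDq<wDp : w (D q) < w (D p)
      wDq<wDp = subst (w (D q) <_) (sym (trans (cong w (toTop-p N p)) w-top)) (s≤s (w-below q∈ q≢p))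

  leftMinima-insert : ∀ t → leftMinima t (suc N) (w ∘ toTop N p) ≡ leftMinima t N w + ⟦ pred p ≤? t ⟧
  leftMinima-insert t = begin
    sumTo (suc N) (λ i → ⟦ southWest (suc N) (w ∘ D) i (w (D i)) ≤? t ⟧)
      ≡⟨ sumTo-cong (suc N) termwise ⟩
    sumTo (suc N) (H ∘ D)
      ≡⟨ sumTo-reindex (suc N) (toTop-permutes p∈) (toTop-injective p∈) H ⟩
    sumTo N H + H (suc N)
      ≡⟨ cong₂ _+_ (sumTo-cong N H-below) H-top ⟩
    leftMinima t N w + ⟦ pred p ≤? t ⟧
      ∎
    where
    D = toTop N p

    H : ℕ → ℕ
    H r = if does (r ≟ suc N) then ⟦ pred p ≤? t ⟧ else ⟦ southWest N w r (w r) ≤? t ⟧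

    H-top : H (suc N) ≡ ⟦ pred p ≤? t ⟧
    H-top = cong (if_then ⟦ pred p ≤? t ⟧ else ⟦ southWest N w (suc N) (w (suc N)) ≤? t ⟧)
                 (dec-true (suc N ≟ suc N) refl)

    H-below : ∀ {r} → r ∈[1, N ] → H r ≡ ⟦ southWest N w r (w r) ≤? t ⟧
    H-below {r} (_ , r≤N) = cong (if_then ⟦ pred p ≤? t ⟧ else ⟦ southWest N w r (w r) ≤? t ⟧)
                                 (dec-false (r ≟ suc N) (<⇒≢ (s≤s r≤N)))

    termwise : ∀ {i} → i ∈[1, suc N ] → ⟦ southWest (suc N) (w ∘ D) i (w (D i)) ≤? t ⟧ ≡ H (D i)
    termwise {i} i∈ with i ≟ p
    ... | yes refl = begin
      ⟦ southWest (suc N) (w ∘ D) p (w (D p)) ≤? t ⟧  ≡⟨ cong (λ n → ⟦ n ≤? t ⟧) southWest-insert-at ⟩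
      ⟦ pred p ≤? t ⟧                                 ≡⟨ H-top ⟨
      H (suc N)                                       ≡⟨ cong H (toTop-p N p) ⟨
      H (D p)                                         ∎
    ... | no i≢p = begin
      ⟦ southWest (suc N) (w ∘ D) i (w (D i)) ≤? t ⟧  ≡⟨ cong (λ n → ⟦ n ≤? t ⟧) (southWest-insert i∈ i≢p) ⟩
      ⟦ southWest N w (D i) (w (D i)) ≤? t ⟧          ≡⟨ H-below (toTop-below p∈ i∈ i≢p) ⟨
      H (D i)                                         ∎

southWest-1 : ∀ N w j → southWest N w 1 j ≡ 0
southWest-1 N w j = sumTo-zero N (λ {q} (1≤q , _) → cong (_* ⟦ w q <? j ⟧) (⟦⟧-no (q <? 1) (≤⇒≯ 1≤q)))

southWest-2 : ∀ N w j → southWest N w 2 j ≤ 1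
southWest-2 zero    w j = z≤n
southWest-2 (suc N) w j =
  ≤-trans (sumTo-mono-≤ (suc N) (λ {q} _ → m*⟦⟧≤m ⟦ q <? 2 ⟧ (w q <? j)))
          (≤-reflexive (sumTo-< (suc N) (s≤s (s≤s z≤n))))
  where
  m*⟦⟧≤m : ∀ {A : Set} m (a? : Dec A) → m * ⟦ a? ⟧ ≤ m
  m*⟦⟧≤m m a? = ≤-trans (*-monoʳ-≤ m (⟦⟧≤1 a?)) (≤-reflexive (*-identityʳ m))

leftMinima₁-∘s₁ : ∀ {N} w → 2 ≤ N → leftMinima 1 N (w ∘ s 1) ≡ leftMinima 1 N w
leftMinima₁-∘s₁ {N} w 2≤N = sumTo-cong N termwise
  where
  termwise : ∀ {i} → i ∈[1, N ] → ⟦ southWest N (w ∘ s 1) i (w (s 1 i)) ≤? 1 ⟧ ≡ ⟦ southWest N w i (w i) ≤? 1 ⟧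
  termwise {1} _ rewrite southWest-1 N (w ∘ s 1) (w 2) | southWest-1 N w (w 1) = refl
  termwise {2} _ = trans (⟦⟧-yes (southWest N (w ∘ s 1) 2 (w 1) ≤? 1) (southWest-2 N (w ∘ s 1) (w 1)))
                        (sym (⟦⟧-yes (southWest N w 2 (w 2) ≤? 1) (southWest-2 N w (w 2))))
  termwise {i@(suc (suc (suc _)))} _ =
    cong (λ n → ⟦ n ≤? 1 ⟧)
         (trans (sumTo-cong N (λ {q} _ → swap-term q)) (sumTo-reindex N (s₁-permutes 2≤N) s₁-injective G))
    where
    G : ℕ → ℕ
    G r = ⟦ r <? i ⟧ * ⟦ w r <? w i ⟧

    swap-term : ∀ q → ⟦ q <? i ⟧ * ⟦ w (s 1 q) <? w i ⟧ ≡ G (s 1 q)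
    swap-term 0                   = refl
    swap-term 1                   = refl
    swap-term 2                   = refl
    swap-term (suc (suc (suc q))) = refl

leftMinima₁-∘s₁^ : ∀ {N} w → 2 ≤ N → ∀ k → leftMinima 1 N (w ∘ s₁^ k) ≡ leftMinima 1 N w
leftMinima₁-∘s₁^ w 2≤N zero    = refl
leftMinima₁-∘s₁^ w 2≤N (suc k) = trans (leftMinima₁-∘s₁^ (w ∘ s 1) 2≤N k) (leftMinima₁-∘s₁ w 2≤N)

-- Factorizations as permutations

descA-factor : ∀ {j k} → k ≤ j → descA j k ≗ s₁^ k ∘ descS (suc j) k
descA-factor {k = zero}              _           x = refl
descA-factor {suc j} {suc zero}      _           x = refl
descA-factor {suc j} {suc (suc k)}   (s≤s k+1≤j) x = cong (s 1) (begin
  s (suc (suc j)) (descA j (suc k) x)                     ≡⟨ cong (s (suc (suc j))) (descA-factor k+1≤j x) ⟩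
  s (suc (suc j)) (s₁^ (suc k) (descS (suc j) (suc k) x))  ≡⟨ s-s₁^-comm 3≤j+2 (suc k) _ ⟩
  s₁^ (suc k) (s (suc (suc j)) (descS (suc j) (suc k) x))  ∎)
  where 3≤j+2 = s≤s (s≤s (≤-trans (s≤s z≤n) k+1≤j))

descS-∘s₂s₁ : ∀ b → descS (suc (suc b)) b ∘ s 2 ∘ s 1 ≗ descS (suc (suc b)) (suc (suc b))
descS-∘s₂s₁ zero    x = refl
descS-∘s₂s₁ (suc b) x = cong (s (suc (suc (suc b)))) (descS-∘s₂s₁ b x)

factorA-factor : ∀ {j k} → k ≤ suc (suc j) → factorA (suc j) k ≗ s₁^ k ∘ descS (suc (suc j)) k
factorA-factor {j} {k} k≤j+2 x with m≤n⇒m<n∨m≡n k≤j+2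
... | inj₁ k<j+2 rewrite dec-true (k ≤? suc j) (s≤s⁻¹ k<j+2) = descA-factor (s≤s⁻¹ k<j+2) x
... | inj₂ refl  rewrite dec-false (suc (suc j) ≤? suc j) (<-irrefl refl) = begin
  descA (suc j) j (s 2 (s 1 x))                            ≡⟨ descA-factor (n≤1+n j) _ ⟩
  s₁^ j (descS (suc (suc j)) j (s 2 (s 1 x)))              ≡⟨ cong (s₁^ j) (descS-∘s₂s₁ j x) ⟩
  s₁^ j (descS (suc (suc j)) (suc (suc j)) x)              ≡⟨ s₁-involutive _ ⟨
  s₁^ (suc (suc j)) (descS (suc (suc j)) (suc (suc j)) x)  ∎

evalS-step : ∀ m c k → evalS (suc m) (c , k) ≗ evalS m c ∘ toTop (suc m) (suc (suc m) ∸ toℕ k)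
evalS-step m c k x = cong (evalS m c) (descS-toTop (toℕ≤pred[n] k) x)

evalA-step : ∀ m v k →
             evalA (suc m) (v , k) ≗ (evalA m v ∘ s₁^ (toℕ k)) ∘ toTop (suc (suc m)) (suc (suc (suc m)) ∸ toℕ k)
evalA-step m v k x =
  cong (evalA m v) (trans (factorA-factor k≤ x) (cong (s₁^ (toℕ k)) (descS-toTop k≤ x)))
  where k≤ = toℕ≤pred[n] k

evalS-permutes : ∀ m c → Permutes (suc m) (evalS m c)
evalS-permutes zero    tt      = Permutes-id
evalS-permutes (suc m) (c , k) = Permutes-≗ (sym ∘ evalS-step m c k)
  (Permutes-∘ (Permutes-suc (evalS-permutes m c)) (toTop-permutes (insertion-point∈ (toℕ≤pred[n] k))))

evalA-permutes : ∀ m v → Permutes (suc (suc m)) (evalA m v)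
evalA-permutes zero    tt      = Permutes-id
evalA-permutes (suc m) (v , k) = Permutes-≗ (sym ∘ evalA-step m v k)
  (Permutes-∘ (Permutes-suc (Permutes-∘ (evalA-permutes m v) (s₁^-permutes (s≤s (s≤s z≤n)) (toℕ k))))
              (toTop-permutes (insertion-point∈ (toℕ≤pred[n] k))))

⟦pred∸≤?⟧ : ∀ N K t → ⟦ pred (suc N ∸ K) ≤? t ⟧ ≡ ⟦ N ≤? t + K ⟧
⟦pred∸≤?⟧ N K t = trans (cong (λ n → ⟦ n ≤? t ⟧) (pred[m∸n]≡m∸[1+n] (suc N) K))
                        (⟦⟧-cong (mk⇔ to from) (N ∸ K ≤? t) (N ≤? t + K))
  where
  to : N ∸ K ≤ t → N ≤ t + K
  to h = subst (N ≤_) (+-comm K t) (≤-trans (m≤n+m∸n N K) (+-monoʳ-≤ K h))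
  from : N ≤ t + K → N ∸ K ≤ t
  from h = m≤n+o⇒m∸n≤o N K (subst (N ≤_) (+-comm t K) h)

leftMinima-evalS : ∀ m c → leftMinima 0 (suc m) (evalS m c) ≡ suc (delS m c)
leftMinima-evalS zero    tt      = refl
leftMinima-evalS (suc m) (c , k) = begin
  leftMinima 0 (suc (suc m)) (evalS (suc m) (c , k))      ≡⟨ leftMinima-cong 0 (suc (suc m)) (evalS-step m c k) ⟩
  leftMinima 0 (suc (suc m)) (evalS m c ∘ toTop (suc m) p) ≡⟨ leftMinima-insert (insertion-point∈ K≤) (evalS-permutes m c) 0 ⟩
  leftMinima 0 (suc m) (evalS m c) + ⟦ pred p ≤? 0 ⟧       ≡⟨ cong₂ _+_ (leftMinima-evalS m c) last-factor ⟩
  suc (delS m c) + ⟦ K ≟ suc m ⟧                           ≡⟨ cong suc (+-comm (delS m c) ⟦ K ≟ suc m ⟧) ⟩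
  suc (delS (suc m) (c , k))                               ∎
  where
  K  = toℕ k
  K≤ = toℕ≤pred[n] k
  p  = suc (suc m) ∸ K

  last-factor : ⟦ pred p ≤? 0 ⟧ ≡ ⟦ K ≟ suc m ⟧
  last-factor = trans (⟦pred∸≤?⟧ (suc m) K 0)
                      (⟦⟧-cong (mk⇔ (≤-antisym K≤) (≤-reflexive ∘ sym)) (suc m ≤? K) (K ≟ suc m))

leftMinima-evalA : ∀ m v → leftMinima 1 (suc (suc m)) (evalA m v) ≡ suc (suc (delA m v))
leftMinima-evalA zero    tt      = refl
leftMinima-evalA (suc m) (v , k) = begin
  leftMinima 1 (suc N) (evalA (suc m) (v , k))             ≡⟨ leftMinima-cong 1 (suc N) (evalA-step m v k) ⟩
  leftMinima 1 (suc N) ((evalA m v ∘ s₁^ K) ∘ toTop N p)   ≡⟨ leftMinima-insert (insertion-point∈ K≤) permutes 1 ⟩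
  leftMinima 1 N (evalA m v ∘ s₁^ K) + ⟦ pred p ≤? 1 ⟧     ≡⟨ cong₂ _+_ swaps-removed (⟦pred∸≤?⟧ N K 1) ⟩
  suc (suc (delA m v)) + ⟦ suc m ≤? K ⟧                    ≡⟨ cong (suc ∘ suc) (+-comm (delA m v) ⟦ suc m ≤? K ⟧) ⟩
  suc (suc (delA (suc m) (v , k)))                         ∎
  where
  N  = suc (suc m)
  K  = toℕ k
  K≤ = toℕ≤pred[n] k
  p  = suc N ∸ K

  permutes : Permutes N (evalA m v ∘ s₁^ K)
  permutes = Permutes-∘ (evalA-permutes m v) (s₁^-permutes (s≤s (s≤s z≤n)) K)

  swaps-removed : leftMinima 1 N (evalA m v ∘ s₁^ K) ≡ suc (suc (delA m v))
  swaps-removed = trans (leftMinima₁-∘s₁^ {N} (evalA m v) (s≤s (s≤s z≤n)) K) (leftMinima-evalA m v)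

delS-inverse : ∀ m c c′ → (∀ x → evalS m c′ (evalS m c x) ≡ x) → delS m c ≡ delS m c′
delS-inverse m c c′ c′∘c = suc-injective (begin
  suc (delS m c)                     ≡⟨ leftMinima-evalS m c ⟨
  leftMinima 0 (suc m) (evalS m c)   ≡⟨ leftMinima-inverse 0 {u = evalS m c′} (evalS-permutes m c) c′∘c ⟨
  leftMinima 0 (suc m) (evalS m c′)  ≡⟨ leftMinima-evalS m c′ ⟩
  suc (delS m c′)                    ∎)

delA-inverse : ∀ m v v′ → (∀ x → evalA m v′ (evalA m v x) ≡ x) → delA m v ≡ delA m v′
delA-inverse m v v′ v′∘v = suc-injective (suc-injective (begin
  suc (suc (delA m v))                     ≡⟨ leftMinima-evalA m v ⟨
  leftMinima 1 (suc (suc m)) (evalA m v)   ≡⟨ leftMinima-inverse 1 {u = evalA m v′} (evalA-permutes m v) v′∘v ⟨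
  leftMinima 1 (suc (suc m)) (evalA m v′)  ≡⟨ leftMinima-evalA m v′ ⟩
  suc (suc (delA m v′))                    ∎))

-- The fibers of f

evalS-injective : ∀ m {c c′} → (∀ {x} → x ∈[1, suc m ] → evalS m c x ≡ evalS m c′ x) → c ≡ c′
evalS-injective zero    {tt}    {tt}      _     = refl
evalS-injective (suc m) {c , k} {c′ , k′} agree = cong₂ _,_ (evalS-injective m agree′) k≡k′
  where
  N  = suc m
  p  = suc N ∸ toℕ k
  p′ = suc N ∸ toℕ k′
  p∈  = insertion-point∈ (toℕ≤pred[n] k)
  p′∈ = insertion-point∈ (toℕ≤pred[n] k′)

  agree-toTop : ∀ {x} → x ∈[1, suc N ] → evalS m c (toTop N p x) ≡ evalS m c′ (toTop N p′ x)
  agree-toTop {x} x∈ = trans (sym (evalS-step m c k x)) (trans (agree x∈) (evalS-step m c′ k′ x))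

  p≡p′ : p ≡ p′
  p≡p′ with p ≟ p′
  ... | yes p≡p′ = p≡p′
  ... | no  p≢p′ = contradiction (trans (sym (agree-toTop p∈)) top-value) (<⇒≢ (s≤s below))
    where
    top-value : evalS m c (toTop N p p) ≡ suc N
    top-value = trans (cong (evalS m c) (toTop-p N p)) (fixes-beyond (evalS-permutes m c) (n<1+n N))
    below : evalS m c′ (toTop N p′ p) ≤ N
    below = proj₂ (into (evalS-permutes m c′) (toTop-below p′∈ p∈ p≢p′))

  k≡k′ : k ≡ k′
  k≡k′ = toℕ-injective
           (∸-cancelˡ-≡ (m≤n⇒m≤1+n (toℕ≤pred[n] k)) (m≤n⇒m≤1+n (toℕ≤pred[n] k′)) p≡p′)

  agree′ : ∀ {y} → y ∈[1, N ] → evalS m c y ≡ evalS m c′ y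
  agree′ y∈ with onto (toTop-permutes p∈) (∈-widen y∈)
  ... | x , x∈ , refl = trans (agree-toTop x∈) (cong (λ q → evalS m c′ (toTop N q x)) (sym p≡p′))

-- Built with _×-dec_ so that deciding (c , k) ≟ᶜ (c′ , k′) reduces to a conjunction,
-- on which fiber-count relies.
_≟ᶜ_ : ∀ {m} → DecidableEquality (SCode m)
_≟ᶜ_ {zero}  tt      tt        = yes refl
_≟ᶜ_ {suc m} (c , k) (c′ , k′) = Dec.map′ (uncurry (cong₂ _,_)) ,-injective ((c ≟ᶜ c′) ×-dec (k Fin.≟ k′))

module _ (n : ℕ) (u w : Perm) where

  -- eqOn folds its list with a function local to Defs, which cannot be named here; the
  -- metavariable in the type of allᵇ≗and is solved to that function by the use below.
  mutual
    private
      allᵇ≗and : ∀ bs → _ ≡ and bs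
      allᵇ≗and = foldr-universal _ _∧_ true refl (λ _ _ → refl)

    eqOn≡all : eqOn n u w ≡ all (λ x → u x ≡ᵇ w x) (map suc (upTo n))
    eqOn≡all with map (λ x → u x ≡ᵇ w x) (map suc (upTo n))
    ... | bs = allᵇ≗and bs

T-eqOn : ∀ n {u w} → T (eqOn n u w) ⇔ (∀ {x} → x ∈[1, n ] → u x ≡ w x)
T-eqOn n {u} {w} = mk⇔ sound complete
  where
  test : ℕ → Bool
  test x = u x ≡ᵇ w x

  sound : T (eqOn n u w) → ∀ {x} → x ∈[1, n ] → u x ≡ w x
  sound eq {suc x} (_ , x<n) =
    ≡ᵇ⇒≡ (u (suc x)) (w (suc x)) (applyUpTo⁻ id n (map⁻ (all⁺ test _ (subst T (eqOn≡all n u w) eq))) x<n)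

  complete : (∀ {x} → x ∈[1, n ] → u x ≡ w x) → T (eqOn n u w)
  complete agree = subst T (sym (eqOn≡all n u w))
    (all⁻ test (map⁺ (applyUpTo⁺₁ id n (λ i<n → ≡⇒≡ᵇ _ _ (agree (s≤s z≤n , i<n))))))

eqOn-evalS : ∀ m {c w} → evalS m c ≗ w → ∀ c′ → eqOn (suc m) (evalS m c′) w ≡ does (c′ ≟ᶜ c)
eqOn-evalS m {c} {w} c≗w c′ = does-⇔ (mk⇔ to from) (T? (eqOn (suc m) (evalS m c′) w)) (c′ ≟ᶜ c)
  where
  to : T (eqOn (suc m) (evalS m c′) w) → c′ ≡ c
  to eq = evalS-injective m
            (λ {x} x∈ → trans (Equivalence.to (T-eqOn (suc m) {evalS m c′} {w}) eq x∈) (sym (c≗w x)))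
  from : c′ ≡ c → T (eqOn (suc m) (evalS m c′) w)
  from refl = Equivalence.from (T-eqOn (suc m) {evalS m c} {w}) (λ {x} _ → c≗w x)

countᵇ : {A : Set} → (A → Bool) → List A → ℕ
countᵇ p xs = length (filterᵇ p xs)

countᵇ-false : {A : Set} (xs : List A) → countᵇ (λ _ → false) xs ≡ 0
countᵇ-false []       = refl
countᵇ-false (_ ∷ xs) = countᵇ-false xs

countᵇ-cong : {A : Set} {p q : A → Bool} → p ≗ q → ∀ xs → countᵇ p xs ≡ countᵇ q xs
countᵇ-cong p≗q []       = refl
countᵇ-cong {q = q} p≗q (x ∷ xs) rewrite p≗q x with q x
... | true  = cong suc (countᵇ-cong p≗q xs)
... | false = countᵇ-cong p≗q xs

countᵇ-++ : {A : Set} (p : A → Bool) (xs ys : List A) → countᵇ p (xs ++ ys) ≡ countᵇ p xs + countᵇ p ys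
countᵇ-++ p xs ys = trans (cong length (filter-++ (T? ∘ p) xs ys)) (length-++ (filterᵇ p xs))

countᵇ-map : {A B : Set} (p : B → Bool) (f : A → B) (xs : List A) → countᵇ p (map f xs) ≡ countᵇ (p ∘ f) xs
countᵇ-map p f []       = refl
countᵇ-map p f (x ∷ xs) with p (f x)
... | true  = cong suc (countᵇ-map p f xs)
... | false = countᵇ-map p f xs

countᵇ-cartesianProduct : {A B : Set} (p : A → Bool) (q : B → Bool) (xs : List A) (ys : List B) →
  countᵇ (λ xy → p (proj₁ xy) ∧ q (proj₂ xy)) (cartesianProduct xs ys) ≡ countᵇ p xs * countᵇ q ys
countᵇ-cartesianProduct p q []       ys = refl
countᵇ-cartesianProduct p q (x ∷ xs) ys = begin
  countᵇ pq (map (x ,_) ys ++ cartesianProduct xs ys)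
    ≡⟨ countᵇ-++ pq (map (x ,_) ys) (cartesianProduct xs ys) ⟩
  countᵇ pq (map (x ,_) ys) + countᵇ pq (cartesianProduct xs ys)
    ≡⟨ cong₂ _+_ (countᵇ-map pq (x ,_) ys) (countᵇ-cartesianProduct p q xs ys) ⟩
  countᵇ (λ y → p x ∧ q y) ys + countᵇ p xs * countᵇ q ys
    ≡⟨ row ⟩
  countᵇ p (x ∷ xs) * countᵇ q ys
    ∎
  where
  pq = λ xy → p (proj₁ xy) ∧ q (proj₂ xy)

  row : countᵇ (λ y → p x ∧ q y) ys + countᵇ p xs * countᵇ q ys ≡ countᵇ p (x ∷ xs) * countᵇ q ys
  row with p x
  ... | true  = refl
  ... | false = cong (_+ countᵇ p xs * countᵇ q ys) (countᵇ-false ys)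

countᵇ-tabulate-suc : ∀ n (p : Fin (suc n) → Bool) → countᵇ p (tabulate Fin.suc) ≡ countᵇ (p ∘ Fin.suc) (allFin n)
countᵇ-tabulate-suc n p = trans (cong (countᵇ p) (sym (map-tabulate id Fin.suc))) (countᵇ-map p Fin.suc (allFin n))

clamp-fiber : ∀ j (k₀ : Fin (suc j)) →
              countᵇ (λ k → does (clamp j k Fin.≟ k₀)) (allFin (suc (suc j))) ≡ 2 ^ ⟦ toℕ k₀ ≟ j ⟧
clamp-fiber zero    Fin.zero     = refl
clamp-fiber (suc j) Fin.zero     =
  cong suc (trans (countᵇ-tabulate-suc (suc (suc j)) (λ k → does (clamp (suc j) k Fin.≟ Fin.zero)))
                  (countᵇ-false (allFin (suc (suc j)))))
clamp-fiber (suc j) (Fin.suc k₀) =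
  trans (countᵇ-tabulate-suc (suc (suc j)) (λ k → does (clamp (suc j) k Fin.≟ Fin.suc k₀))) (clamp-fiber j k₀)

fiber-count : ∀ m c → countᵇ (λ v → does (fCode m v ≟ᶜ c)) (allACode m) ≡ 2 ^ delS m c
fiber-count zero    tt       = refl
fiber-count (suc m) (c , k₀) = begin
  countᵇ (λ v → does (fCode m (proj₁ v) ≟ᶜ c) ∧ does (clamp (suc m) (proj₂ v) Fin.≟ k₀))
         (cartesianProduct (allACode m) (allFin (suc (suc (suc m)))))
    ≡⟨ countᵇ-cartesianProduct _ _ (allACode m) (allFin (suc (suc (suc m)))) ⟩
  countᵇ (λ v → does (fCode m v ≟ᶜ c)) (allACode m)
    * countᵇ (λ k → does (clamp (suc m) k Fin.≟ k₀)) (allFin (suc (suc (suc m))))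
    ≡⟨ cong₂ _*_ (fiber-count m c) (clamp-fiber (suc m) k₀) ⟩
  2 ^ delS m c * 2 ^ ⟦ toℕ k₀ ≟ suc m ⟧
    ≡⟨ *-comm (2 ^ delS m c) _ ⟩
  2 ^ ⟦ toℕ k₀ ≟ suc m ⟧ * 2 ^ delS m c
    ≡⟨ ^-distribˡ-+-* 2 ⟦ toℕ k₀ ≟ suc m ⟧ (delS m c) ⟨
  2 ^ delS (suc m) (c , k₀)
    ∎

fiberSize-evalS : ∀ m w c → evalS m c ≗ w → fiberSize (suc m) w ≡ 2 ^ delS m c
fiberSize-evalS m w c c≗w = trans (countᵇ-cong (eqOn-evalS m c≗w ∘ fCode m) (allACode m)) (fiber-count m c)

proposition5p5 : (n : ℕ) → 2 ≤ n →
      ((w : Perm) (c : SWord n) → (∀ x → evalS (n ∸ 1) c x ≡ w x) →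
          fiberSize n w ≡ 2 ^ delS (n ∸ 1) c)
    × ((c c' : SWord n) → (∀ x → evalS (n ∸ 1) c' (evalS (n ∸ 1) c x) ≡ x) →
          delS (n ∸ 1) c ≡ delS (n ∸ 1) c')
    × ((v v' : AWord n) → (∀ x → evalA (n ∸ 1) v' (evalA (n ∸ 1) v x) ≡ x) →
          delA (n ∸ 1) v ≡ delA (n ∸ 1) v')
proposition5p5 zero    ()
proposition5p5 (suc n) _ = fiberSize-evalS n , delS-inverse n , delA-inverse n
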